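{- Let $p$ be a prime, $q=p^m$, and $F(X)=X^r\left(X^{\alpha(q-1)}+X^{\beta(q-1)}+1\right)$, where $m,\alpha,\beta,r$ are positive integers. If $\gcd(\alpha,\beta,r,q+1)\ne 1$, then $F(X)$ is not a permutation polynomial of $\mathbb{F}_{q^2}$.
   Context: A polynomial $f\in\mathbb{F}_{q^2}[X]$ is a permutation polynomial of $\mathbb{F}_{q^2}$ if the map $x\mapsto f(x)$ is a bijection of $\mathbb{F}_{q^2}$. -}

module Defs where

open import Level using (Level; _⊔_)
open import Data.Nat using (ℕ; zero; suc)
import Data.Nat
open import Data.Fin using (Fin)
open import Data.Product using (∃; _×_)
open import Relation.Nullary using (¬_)
open import Relation.Binary.PropositionalEquality using (_≡_)
open import Algebra.Bundles using (CommutativeRing)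
open import Function.Definitions using (Injective; Surjective)

record Field (c ℓ : Level) : Set (Level.suc (c ⊔ ℓ)) where
  field
    commutativeRing : CommutativeRing c ℓ
  open CommutativeRing commutativeRing public
  field
    1≉0     : ¬ (1# ≈ 0#)
    inverse : ∀ x → ¬ (x ≈ 0#) → ∃ λ y → (x * y) ≈ 1#

module _ {c ℓ} (K : Field c ℓ) where
  open Field K

  pow : Carrier → ℕ → Carrier
  pow x zero    = 1#
  pow x (suc n) = x * pow x n

  HasCard : ℕ → Set (c ⊔ ℓ)
  HasCard n = ∃ λ (e : Fin n → Carrier) →
    (∀ i j → e i ≈ e j → i ≡ j) × (∀ x → ∃ λ i → e i ≈ x)

  IsPermutation : (Carrier → Carrier) → Set (c ⊔ ℓ)
  IsPermutation f = Injective _≈_ _≈_ f × Surjective _≈_ _≈_ f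

  Fpoly : ℕ → ℕ → ℕ → ℕ → Carrier → Carrier
  Fpoly q α β r x =
    pow x r * ((pow x (α Data.Nat.* (q Data.Nat.∸ 1)) + pow x (β Data.Nat.* (q Data.Nat.∸ 1))) + 1#)

module Submission where

-- Let d = gcd(α, β, r, q + 1) > 1 and M = q² - 1, so that d ∣ M. For every unit y,
-- ω = y^(M/d) satisfies ω^d = y^M = 1, and since d divides r, α(q - 1) and β(q - 1),
-- F(ω) = 3 = F(1). An injective F would therefore force y^(M/d) = 1 for all M units,
-- whereas X^(M/d) - 1 has at most M/d < M roots.

open import Defs
open import Data.Nat using (ℕ; _≥_)
open import Data.Nat.GCD using (gcd)
open import Data.Nat.Primality using (Prime)
open import Relation.Nullary using (¬_)
open import Relation.Binary.PropositionalEquality using (_≡_; _≢_)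

import Data.Nat as Nat
open Nat using (zero; suc; _≤_; _<_; z≤n; s≤s; NonZero)
import Data.Nat.Properties as ℕₚ
open import Data.Nat.Divisibility using (_∣_; divides; ∣-trans; ∣m⇒∣m*n; ∣n⇒∣m*n)
open import Data.Nat.GCD using (gcd[m,n]∣m; gcd[m,n]∣n; gcd[m,n]≢0)
open import Data.Nat.Primality using (prime⇒nonZero)
open import Data.Nat.Tactic.RingSolver using () renaming (solve-∀ to ℕ-solve-∀)
open import Data.Fin using (Fin; punchIn; punchOut) renaming (zero to fzero; suc to fsuc)
open import Data.Fin.Properties using (¬Fin0; 0≢1+n; suc-injective; punchIn-injective; punchInᵢ≢i)
open import Data.Fin.Permutation using (Permutation; permutation; remove; punchIn-permute; _⟨$⟩ʳ_)
open import Data.Vec using (Vec; []; _∷_; replicate)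
open import Data.Product using (∃; _,_; proj₁; proj₂)
open import Data.Sum using (inj₂)
open import Function.Definitions using (Injective)
open import Function.Base using (_∘_)
open import Relation.Nullary using (contradiction)
import Relation.Binary.PropositionalEquality as ≡
import Algebra.Solver.Ring.NaturalCoefficients.Default as SemiringSolver
import Algebra.Properties.Ring as RingProperties
import Algebra.Properties.Semiring.Exp as Exp
import Algebra.Properties.CommutativeMonoid.Sum as Sum
import Algebra.Properties.Group as GroupProperties

module FieldTheory {c ℓ} (K : Field c ℓ) where
  open Field K
  open Exp semiring using (_^_; ^-congˡ; ^-assocʳ)
  open Sum *-commutativeMonoid using (sum-cong-≋; sum-replicate; ∑-distrib-+; ∑-permute)
    renaming (sum to ∏)
  open GroupProperties +-group using (x∙y⁻¹≈ε⇒x≈y)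
  open import Relation.Binary.Reasoning.Setoid setoid

  open SemiringSolver commutativeSemiring using (solve; _:=_; _:+_; _:*_)
  open RingProperties ring using (-‿distribˡ-*)

  pow≡^ : ∀ x n → pow K x n ≡ x ^ n
  pow≡^ x zero    = ≡.refl
  pow≡^ x (suc n) = ≡.cong (x *_) (pow≡^ x n)

  1^n≈1 : ∀ n → 1# ^ n ≈ 1#
  1^n≈1 zero    = refl
  1^n≈1 (suc n) = trans (*-identityˡ _) (1^n≈1 n)

  ^≈1-∣ : ∀ {x d n} → x ^ d ≈ 1# → d ∣ n → x ^ n ≈ 1#
  ^≈1-∣ {x} {d} {n} xᵈ≈1 (divides t ≡.refl) = begin
    x ^ (t Nat.* d)  ≡⟨ ≡.cong (x ^_) (ℕₚ.*-comm t d) ⟩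
    x ^ (d Nat.* t)  ≈⟨ ^-assocʳ x d t ⟨
    (x ^ d) ^ t      ≈⟨ ^-congˡ t xᵈ≈1 ⟩
    1# ^ t           ≈⟨ 1^n≈1 t ⟩
    1#               ∎

  *-cancelʳ : ∀ {x y z} → ¬ z ≈ 0# → x * z ≈ y * z → x ≈ y
  *-cancelʳ {x} {y} {z} z≉0 xz≈yz with inverse z z≉0
  ... | z⁻¹ , zz⁻¹≈1 = begin
    x                ≈⟨ *-identityʳ x ⟨
    x * 1#           ≈⟨ *-congˡ zz⁻¹≈1 ⟨
    x * (z * z⁻¹)    ≈⟨ *-assoc x z z⁻¹ ⟨
    (x * z) * z⁻¹    ≈⟨ *-congʳ xz≈yz ⟩
    (y * z) * z⁻¹    ≈⟨ *-assoc y z z⁻¹ ⟩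
    y * (z * z⁻¹)    ≈⟨ *-congˡ zz⁻¹≈1 ⟩
    y * 1#           ≈⟨ *-identityʳ y ⟩
    y                ∎

  x*y≈0⇒y≈0 : ∀ {x y} → ¬ x ≈ 0# → x * y ≈ 0# → y ≈ 0#
  x*y≈0⇒y≈0 {x} {y} x≉0 xy≈0 =
    *-cancelʳ x≉0 (trans (*-comm y x) (trans xy≈0 (sym (zeroˡ x))))

  x*z≈y*z⇒z≈0 : ∀ {x y z} → ¬ x ≈ y → x * z ≈ y * z → z ≈ 0#
  x*z≈y*z⇒z≈0 {x} {y} {z} x≉y xz≈yz = x*y≈0⇒y≈0 (x≉y ∘ x∙y⁻¹≈ε⇒x≈y x y) (begin
    (x - y) * z        ≈⟨ distribʳ z x (- y) ⟩
    x * z + - y * z    ≈⟨ +-congˡ (-‿distribˡ-* y z) ⟨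
    x * z + - (y * z)  ≈⟨ +-congˡ (-‿cong xz≈yz) ⟨
    x * z + - (x * z)  ≈⟨ -‿inverseʳ (x * z) ⟩
    0#                 ∎)

  ∏≉0 : ∀ {n} (u : Fin n → Carrier) → (∀ i → ¬ u i ≈ 0#) → ¬ ∏ u ≈ 0#
  ∏≉0 {zero}  u u≉0 = 1≉0
  ∏≉0 {suc n} u u≉0 ∏u≈0 =
    ∏≉0 (λ i → u (fsuc i)) (λ i → u≉0 (fsuc i)) (x*y≈0⇒y≈0 (u≉0 fzero) ∏u≈0)

  ^≈1-if-scaling-permutes : ∀ {n a} (u : Fin n → Carrier) → (∀ i → ¬ u i ≈ 0#) →
    (ρ : Permutation n n) → (∀ i → u (ρ ⟨$⟩ʳ i) ≈ a * u i) → a ^ n ≈ 1#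
  ^≈1-if-scaling-permutes {n} {a} u u≉0 ρ u∘ρ≈au = *-cancelʳ (∏≉0 u u≉0) (begin
    a ^ n * ∏ u                  ≈⟨ *-congʳ (sum-replicate n {a}) ⟨
    ∏ (λ (_ : Fin n) → a) * ∏ u  ≈⟨ ∑-distrib-+ (λ _ → a) u ⟨
    ∏ (λ i → a * u i)            ≈⟨ sum-cong-≋ u∘ρ≈au ⟨
    ∏ (λ i → u (ρ ⟨$⟩ʳ i))       ≈⟨ ∑-permute u ρ ⟨
    ∏ u                          ≈⟨ *-identityˡ (∏ u) ⟨
    1# * ∏ u                     ∎)

  -- A monic polynomial of degree k, Horner-encoded by its k lower coefficients.
  Monic : ℕ → Set c
  Monic = Vec Carrier

  ⟦_⟧ : ∀ {k} → Monic k → Carrier → Carrier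
  ⟦ []     ⟧ x = 1#
  ⟦ a ∷ cs ⟧ x = a + x * ⟦ cs ⟧ x

  -- Division by X - a, with both sides moved so that no subtraction occurs
  -- (each step is then a semiring identity).
  factor-theorem : ∀ {k} (cs : Monic (suc k)) a → ∃ λ (qs : Monic k) →
    ∀ x → ⟦ cs ⟧ x + a * ⟦ qs ⟧ x ≈ x * ⟦ qs ⟧ x + ⟦ cs ⟧ a
  factor-theorem (b ∷ []) a = [] , λ x →
    solve 4 (λ b x a o → (b :+ x :* o) :+ a :* o := x :* o :+ (b :+ a :* o)) refl b x a 1#
  factor-theorem (b ∷ cs@(_ ∷ _)) a with factor-theorem cs a
  ... | qs , cs≈ = (⟦ cs ⟧ a ∷ qs) , λ x → begin
    (b + x * ⟦ cs ⟧ x) + a * (⟦ cs ⟧ a + x * ⟦ qs ⟧ x)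
      ≈⟨ solve 6 (λ b x a c c' q → (b :+ x :* c) :+ a :* (c' :+ x :* q)
                                  := (b :+ x :* (c :+ a :* q)) :+ a :* c')
               refl b x a (⟦ cs ⟧ x) (⟦ cs ⟧ a) (⟦ qs ⟧ x) ⟩
    (b + x * (⟦ cs ⟧ x + a * ⟦ qs ⟧ x)) + a * ⟦ cs ⟧ a
      ≈⟨ +-congʳ (+-congˡ (*-congˡ (cs≈ x))) ⟩
    (b + x * (x * ⟦ qs ⟧ x + ⟦ cs ⟧ a)) + a * ⟦ cs ⟧ a
      ≈⟨ solve 5 (λ b x a c' q → (b :+ x :* (x :* q :+ c')) :+ a :* c'
                                := x :* (c' :+ x :* q) :+ (b :+ a :* c'))
               refl b x a (⟦ cs ⟧ a) (⟦ qs ⟧ x) ⟩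
    x * (⟦ cs ⟧ a + x * ⟦ qs ⟧ x) + (b + a * ⟦ cs ⟧ a) ∎

  roots≤degree : ∀ {k m} (cs : Monic k) (f : Fin m → Carrier) → Injective _≡_ _≈_ f →
    (∀ i → ⟦ cs ⟧ (f i) ≈ 0#) → m ≤ k
  roots≤degree {m = zero}  cs       f f-inj roots = z≤n
  roots≤degree {m = suc m} []       f f-inj roots = contradiction (roots fzero) 1≉0
  roots≤degree {m = suc m} (b ∷ cs) f f-inj roots with factor-theorem (b ∷ cs) (f fzero)
  ... | qs , factored = s≤s (roots≤degree qs (λ i → f (fsuc i))
                             (λ eq → suc-injective (f-inj eq)) quotient-roots)
    where
    quotient-roots : ∀ i → ⟦ qs ⟧ (f (fsuc i)) ≈ 0#
    quotient-roots i = x*z≈y*z⇒z≈0 (λ f0≈x → 0≢1+n (f-inj f0≈x)) (begin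
      f fzero * ⟦ qs ⟧ x                        ≈⟨ +-identityˡ _ ⟨
      0# + f fzero * ⟦ qs ⟧ x                   ≈⟨ +-congʳ (roots (fsuc i)) ⟨
      ⟦ b ∷ cs ⟧ x + f fzero * ⟦ qs ⟧ x         ≈⟨ factored x ⟩
      x * ⟦ qs ⟧ x + ⟦ b ∷ cs ⟧ (f fzero)       ≈⟨ +-congˡ (roots fzero) ⟩
      x * ⟦ qs ⟧ x + 0#                         ≈⟨ +-identityʳ _ ⟩
      x * ⟦ qs ⟧ x                              ∎)
      where
      x = f (fsuc i)

  X^[1+n]-1 : ∀ n → Monic (suc n)
  X^[1+n]-1 n = - 1# ∷ replicate n 0#

  ⟦0ⁿ⟧≈^ : ∀ n x → ⟦ replicate n 0# ⟧ x ≈ x ^ n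
  ⟦0ⁿ⟧≈^ zero    x = refl
  ⟦0ⁿ⟧≈^ (suc n) x = trans (+-identityˡ _) (*-congˡ (⟦0ⁿ⟧≈^ n x))

  root-of-X^[1+n]-1 : ∀ n {x} → x ^ suc n ≈ 1# → ⟦ X^[1+n]-1 n ⟧ x ≈ 0#
  root-of-X^[1+n]-1 n {x} x¹⁺ⁿ≈1 = begin
    - 1# + x * ⟦ replicate n 0# ⟧ x ≈⟨ +-congˡ (*-congˡ (⟦0ⁿ⟧≈^ n x)) ⟩
    - 1# + x ^ suc n                ≈⟨ +-congˡ x¹⁺ⁿ≈1 ⟩
    - 1# + 1#                       ≈⟨ -‿inverseˡ 1# ⟩
    0#                              ∎

  module FiniteField {M} (card : HasCard K (suc M)) where

    enum : Fin (suc M) → Carrier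
    enum = proj₁ card

    enum-injective : Injective _≡_ _≈_ enum
    enum-injective = proj₁ (proj₂ card) _ _

    index : Carrier → Fin (suc M)
    index x = proj₁ (proj₂ (proj₂ card) x)

    enum-index : ∀ x → enum (index x) ≈ x
    enum-index x = proj₂ (proj₂ (proj₂ card) x)

    unit : Fin M → Carrier
    unit j = enum (punchIn (index 0#) j)

    unit-injective : Injective _≡_ _≈_ unit
    unit-injective = punchIn-injective (index 0#) _ _ ∘ enum-injective

    unit≉0 : ∀ j → ¬ unit j ≈ 0#
    unit≉0 j unit≈0 =
      punchInᵢ≢i (index 0#) j (enum-injective (trans unit≈0 (sym (enum-index 0#))))

    M≢0 : M ≢ 0
    M≢0 M≡0 = ¬Fin0 (≡.subst Fin M≡0 (punchOut index0≢index1))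
      where
      index0≢index1 : index 0# ≢ index 1#
      index0≢index1 eq = 1≉0 (begin
        1#               ≈⟨ enum-index 1# ⟨
        enum (index 1#)  ≡⟨ ≡.cong enum eq ⟨
        enum (index 0#)  ≈⟨ enum-index 0# ⟩
        0#               ∎)

    scaleBy : Carrier → Fin (suc M) → Fin (suc M)
    scaleBy a i = index (a * enum i)

    scaleBy-inverse : ∀ {a b} → b * a ≈ 1# → ∀ i → scaleBy b (scaleBy a i) ≡ i
    scaleBy-inverse {a} {b} ba≈1 i = enum-injective (begin
      enum (scaleBy b (scaleBy a i)) ≈⟨ enum-index _ ⟩
      b * enum (scaleBy a i)         ≈⟨ *-congˡ (enum-index _) ⟩
      b * (a * enum i)               ≈⟨ *-assoc b a (enum i) ⟨
      (b * a) * enum i               ≈⟨ *-congʳ ba≈1 ⟩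
      1# * enum i                    ≈⟨ *-identityˡ (enum i) ⟩
      enum i                         ∎)

    scaling : ∀ {a} → ¬ a ≈ 0# → Permutation (suc M) (suc M)
    scaling {a} a≉0 = permutation (scaleBy a) (scaleBy a⁻¹)
      (scaleBy-inverse aa⁻¹≈1) (scaleBy-inverse (trans (*-comm a⁻¹ a) aa⁻¹≈1))
      where
      a⁻¹ = proj₁ (inverse a a≉0)
      aa⁻¹≈1 = proj₂ (inverse a a≉0)

    scaling-fixes-0 : ∀ {a} (a≉0 : ¬ a ≈ 0#) → scaling a≉0 ⟨$⟩ʳ index 0# ≡ index 0#
    scaling-fixes-0 {a} a≉0 = enum-injective (begin
      enum (scaleBy a (index 0#)) ≈⟨ enum-index _ ⟩
      a * enum (index 0#)         ≈⟨ *-congˡ (enum-index 0#) ⟩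
      a * 0#                      ≈⟨ zeroʳ a ⟩
      0#                          ≈⟨ enum-index 0# ⟨
      enum (index 0#)             ∎)

    unitScaling : ∀ {a} → ¬ a ≈ 0# → Permutation M M
    unitScaling a≉0 = remove (index 0#) (scaling a≉0)

    unit-unitScaling : ∀ {a} (a≉0 : ¬ a ≈ 0#) j → unit (unitScaling a≉0 ⟨$⟩ʳ j) ≈ a * unit j
    unit-unitScaling {a} a≉0 j = begin
      enum (punchIn (index 0#) (ρ j))
        ≡⟨ ≡.cong (λ k → enum (punchIn k (ρ j))) (scaling-fixes-0 a≉0) ⟨
      enum (punchIn (σ (index 0#)) (ρ j))
        ≡⟨ ≡.cong enum (punchIn-permute (scaling a≉0) (index 0#) j) ⟨
      enum (σ (punchIn (index 0#) j))
        ≈⟨ enum-index _ ⟩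
      a * unit j ∎
      where
      σ = scaling a≉0 ⟨$⟩ʳ_
      ρ = unitScaling a≉0 ⟨$⟩ʳ_

    fermat : ∀ {a} → ¬ a ≈ 0# → a ^ M ≈ 1#
    fermat a≉0 = ^≈1-if-scaling-permutes unit unit≉0 (unitScaling a≉0) (unit-unitScaling a≉0)

    M≤1+n-if-units-are-roots : ∀ n → (∀ x → ¬ x ≈ 0# → x ^ suc n ≈ 1#) → M ≤ suc n
    M≤1+n-if-units-are-roots n xⁿ⁺¹≈1 = roots≤degree (X^[1+n]-1 n) unit unit-injective
      (λ j → root-of-X^[1+n]-1 n (xⁿ⁺¹≈1 (unit j) (unit≉0 j)))

    constant-on-roots-of-unity⇒¬injective : ∀ {d} → 1 < d → d ∣ M → (f : Carrier → Carrier) →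
      (∀ ω → ω ^ d ≈ 1# → f ω ≈ f 1#) → ¬ Injective _≈_ _≈_ f
    constant-on-roots-of-unity⇒¬injective 1<d (divides zero M≡0) f f-const f-inj = M≢0 M≡0
    constant-on-roots-of-unity⇒¬injective {d} 1<d (divides (suc t) M≡1+t*d) f f-const f-inj =
      ℕₚ.<⇒≱ (ℕₚ.m<m*n (suc t) d 1<d)
        (≡.subst (_≤ suc t) M≡1+t*d (M≤1+n-if-units-are-roots t y¹⁺ᵗ≈1))
      where
      y¹⁺ᵗ≈1 : ∀ y → ¬ y ≈ 0# → y ^ suc t ≈ 1#
      y¹⁺ᵗ≈1 y y≉0 = f-inj (f-const (y ^ suc t) (begin
        (y ^ suc t) ^ d      ≈⟨ ^-assocʳ y (suc t) d ⟩
        y ^ (suc t Nat.* d)  ≡⟨ ≡.cong (y ^_) M≡1+t*d ⟨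
        y ^ M                ≈⟨ fermat y≉0 ⟩
        1#                   ∎))

  pow≈1-∣ : ∀ {x d n} → x ^ d ≈ 1# → d ∣ n → pow K x n ≈ 1#
  pow≈1-∣ {x} {d} {n} xᵈ≈1 d∣n = trans (reflexive (pow≡^ x n)) (^≈1-∣ xᵈ≈1 d∣n)

  Fpoly-constant-on-roots-of-unity : ∀ {d α β r} q → d ∣ α → d ∣ β → d ∣ r →
    ∀ ω → ω ^ d ≈ 1# → Fpoly K q α β r ω ≈ Fpoly K q α β r 1#
  Fpoly-constant-on-roots-of-unity {d} {α} {β} {r} q d∣α d∣β d∣r ω ωᵈ≈1 =
    trans (Fpoly≈3 ωᵈ≈1) (sym (Fpoly≈3 (1^n≈1 d)))
    where
    Fpoly≈3 : ∀ {x} → x ^ d ≈ 1# → Fpoly K q α β r x ≈ 1# * ((1# + 1#) + 1#)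
    Fpoly≈3 xᵈ≈1 = *-cong (pow≈1-∣ xᵈ≈1 d∣r)
      (+-congʳ (+-cong (pow≈1-∣ xᵈ≈1 (∣m⇒∣m*n (q Nat.∸ 1) d∣α))
                       (pow≈1-∣ xᵈ≈1 (∣m⇒∣m*n (q Nat.∸ 1) d∣β))))

-- Imported only here: inside FieldTheory they would clash with the field's operations.
open import Data.Nat using (_+_; _^_)

q²≡1+[q∸1][q+1] : ∀ q → .{{NonZero q}} → q ^ 2 ≡ suc ((q Nat.∸ 1) Nat.* (q + 1))
q²≡1+[q∸1][q+1] (suc n) = identity n
  where
  -- suc k ^ 2 unfolded, since the solver does not recognise ℕ's _^_
  identity : ∀ k → (1 + k) Nat.* ((1 + k) Nat.* 1) ≡ 1 + k Nat.* ((1 + k) + 1)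
  identity = ℕ-solve-∀

n≢0∧n≢1⇒1<n : ∀ {n} → n ≢ 0 → n ≢ 1 → 1 < n
n≢0∧n≢1⇒1<n {zero}        n≢0 n≢1 = contradiction ≡.refl n≢0
n≢0∧n≢1⇒1<n {suc zero}    n≢0 n≢1 = contradiction ≡.refl n≢1
n≢0∧n≢1⇒1<n {suc (suc n)} n≢0 n≢1 = s≤s (s≤s z≤n)

lemma6p1 : ∀ {c ℓ} (p m α β r : ℕ) → Prime p → m ≥ 1 → α ≥ 1 → β ≥ 1 → r ≥ 1 →
    (K : Field c ℓ) → HasCard K ((p ^ m) ^ 2) →
    gcd (gcd (gcd α β) r) (p ^ m + 1) ≢ 1 →
    ¬ IsPermutation K (Fpoly K (p ^ m) α β r)
lemma6p1 p m α β r p-prime _ _ _ _ K card d≢1 (F-injective , _) =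
  constant-on-roots-of-unity⇒¬injective 1<d (∣n⇒∣m*n (q Nat.∸ 1) d∣q+1) (Fpoly K q α β r)
    (Fpoly-constant-on-roots-of-unity q d∣α d∣β d∣r) F-injective
  where
  q = p ^ m
  instance
    q≢0 : NonZero q
    q≢0 = ℕₚ.m^n≢0 p m {{prime⇒nonZero p-prime}}
  open FieldTheory K
  open FiniteField (≡.subst (HasCard K) (q²≡1+[q∸1][q+1] q) card)
  d = gcd (gcd (gcd α β) r) (q + 1)
  d∣q+1 : d ∣ q + 1
  d∣q+1 = gcd[m,n]∣n (gcd (gcd α β) r) (q + 1)
  d∣αβr : d ∣ gcd (gcd α β) r
  d∣αβr = gcd[m,n]∣m (gcd (gcd α β) r) (q + 1)
  d∣r : d ∣ r
  d∣r = ∣-trans d∣αβr (gcd[m,n]∣n (gcd α β) r)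
  d∣αβ : d ∣ gcd α β
  d∣αβ = ∣-trans d∣αβr (gcd[m,n]∣m (gcd α β) r)
  d∣α : d ∣ α
  d∣α = ∣-trans d∣αβ (gcd[m,n]∣m α β)
  d∣β : d ∣ β
  d∣β = ∣-trans d∣αβ (gcd[m,n]∣n α β)
  1<d : 1 < d
  1<d = n≢0∧n≢1⇒1<n (gcd[m,n]≢0 (gcd (gcd α β) r) (q + 1) (inj₂ (ℕₚ.m+1+n≢0 q))) d≢1
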